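{- Let $(P,\le_P)$ be a finite poset on $[N]$ with antichains enumerated $S_1,\dots,S_m$, where $S_m=\emptyset$. The map $f_1$ (defined below) is an injection from $\mathrm{hom}_P(\mathcal{P}(n))$ into $[m]^{[n]}$.
   Context: $\mathcal{P}(n)$ is the power set of $[n]$ ordered by inclusion; $\mathrm{hom}_P(\mathcal{P}(n))$ is the set of maps $\phi:P\to\mathcal{P}(n)$ with $x\le_P y\Rightarrow\phi(x)\subseteq\phi(y)$. $[m]^{[n]}$ is the set of $m$-tuples $(A_1,\dots,A_m)$ of pairwise disjoint (possibly empty) subsets of $[n]$ with union $[n]$. For $\phi\in\mathrm{hom}_P(\mathcal{P}(n))$, define: $X_i=\phi(i)$ for $i\in[N]$; $Y_i=X_i\setminus\bigcup_{j<_Pi}X_j$; for $j\in[m-1]$, $Z_j=\bigcap_{i\in S_j}Y_i$ and $A_j=Z_j\setminus\bigcup_{k:\,S_k\supsetneq S_j}Z_k$ (union over antichains $S_k$ strictly containing $S_j$); $A_m=[n]\setminus\bigcup_{j\in[m-1]}A_j$. Then $f_1(\phi)=(A_1,\dots,A_m)$. -}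

module Defs where

open import Data.Nat using (ℕ; zero; suc)
open import Data.Fin using (Fin; zero; suc; inject₁; fromℕ)
open import Data.Fin.Subset using (Subset; _∈_; _⊆_; _⊂_; _∩_; _∪_; _─_; ∁; ⋃; ⋂; ⊥; ⊤)
open import Data.Fin.Subset.Properties using (_∈?_; _⊂?_)
open import Data.Fin.Properties using (_≟_)
open import Data.List.Base using (List; map; filter; allFin)
open import Data.Product using (_×_; Σ; ∃)
open import Relation.Nullary using (¬_; Dec; yes; no)
open import Relation.Nullary.Decidable using (_×-dec_; ¬?)
open import Relation.Binary using (Rel; Decidable; IsPartialOrder)
open import Relation.Binary.PropositionalEquality using (_≡_)
open import Function.Definitions using (Injective)

-- A finite poset on [N] = Fin N, with decidable order (needed to compute f₁).
record FinPoset (N : ℕ) : Set₁ where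
  field
    _≤P_      : Rel (Fin N) _
    isPartial : IsPartialOrder _≡_ _≤P_
    _≤P?_     : Decidable _≤P_

IsAntichain : ∀ {N} → FinPoset N → Subset N → Set
IsAntichain {N} P S = ∀ (x y : Fin N) → x ∈ S → y ∈ S → x ≤P y → x ≡ y
  where open FinPoset P

IsAntichainEnum : ∀ {N m} → FinPoset N → (Fin m → Subset N) → Set
IsAntichainEnum {N} {m} P S =
  (∀ k → IsAntichain P (S k)) ×
  (∀ (T : Subset N) → IsAntichain P T → ∃ λ k → S k ≡ T) ×
  (∀ k l → S k ≡ S l → k ≡ l)

IsHom : ∀ {N} (P : FinPoset N) (n : ℕ) → (Fin N → Subset n) → Set
IsHom {N} P n φ = ∀ (x y : Fin N) → x ≤P y → φ x ⊆ φ y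
  where open FinPoset P

-- [m]^{[n]}: m-tuples of pairwise disjoint subsets of [n] with union [n]
IsOrderedPartition : ∀ {m n} → (Fin m → Subset n) → Set
IsOrderedPartition {m} {n} A =
  (∀ (j k : Fin m) → ¬ (j ≡ k) → ∀ (x : Fin n) → x ∈ A j → x ∈ A k → Data.Empty.⊥) ×
  (∀ (x : Fin n) → ∃ λ j → x ∈ A j)
  where import Data.Empty

-- Extend a family indexed by [m-1] with an m-th entry (placed at index fromℕ m').
snoc : ∀ {m'} {A : Set} → (Fin m' → A) → A → Fin (suc m') → A
snoc {zero}   f a zero    = a
snoc {suc m'} f a zero    = f zero
snoc {suc m'} f a (suc k) = snoc (λ i → f (suc i)) a k

-- The map f₁.  The antichains are S : Fin (suc m') → Subset N, with
-- S_j (j ∈ [m-1]) = S (inject₁ j) and S_m = S (fromℕ m').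
module F1 {N : ℕ} (P : FinPoset N) {m' : ℕ} (S : Fin (suc m') → Subset N)
          {n : ℕ} (φ : Fin N → Subset n) where
  open FinPoset P

  X : Fin N → Subset n
  X i = φ i

  _<P?_ : Decidable (λ j i → (j ≤P i) × ¬ (j ≡ i))
  j <P? i = (j ≤P? i) ×-dec ¬? (j ≟ i)

  Y : Fin N → Subset n
  Y i = X i ─ ⋃ (map X (filter (λ j → j <P? i) (allFin N)))

  Z : Fin m' → Subset n
  Z j = ⋂ (map Y (filter (λ i → i ∈? S (inject₁ j)) (allFin N)))

  Aj : Fin m' → Subset n
  Aj j = Z j ─ ⋃ (map Z (filter (λ k → S (inject₁ j) ⊂? S (inject₁ k)) (allFin m')))

  Am : Subset n
  Am = ∁ (⋃ (map Aj (allFin m')))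

  f₁ : Fin (suc m') → Subset n
  f₁ = snoc Aj Am

f₁ : ∀ {N} (P : FinPoset N) {m'} (S : Fin (suc m') → Subset N) {n}
     → (Fin N → Subset n) → Fin (suc m') → Subset n
f₁ P S φ = F1.f₁ P S φ

module Submission where

-- The map f₁ is read through the "trace" of a point.  For φ : P → 𝒫(n) and
-- x ∈ [n], let  trace x = {i ∈ P : x ∈ Yᵢ}.  Unfolding Yᵢ, i ∈ trace x
-- says that i is a minimal element of the set {i : x ∈ φ(i)}, so trace x is
-- an antichain.  Unfolding Zⱼ gives  x ∈ Zⱼ ⇔ Sⱼ ⊆ trace x,  and then
-- x ∈ Aⱼ ⇔ trace x = Sⱼ  for j < m: no strictly larger antichain Sₖ can
-- contain Sⱼ inside trace x, because trace x is itself some Sₖ, and Sₘ = ∅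
-- is never a strict superset.  Aₘ collects the remaining points, whose
-- trace is Sₘ.  Hence   f₁(φ)ₖ = {x : trace x = Sₖ}  for every k.
--
-- Since every antichain is exactly one Sₖ, f₁(φ) is an ordered partition,
-- and f₁(φ) determines the trace of every point.  For a homomorphism φ,
-- x ∈ φ(i) iff some element of trace x lies below i (going down to a
-- minimal element uses that finite posets are well-founded), so f₁(φ)
-- determines φ.

open import Defs
open import Data.Nat using (ℕ; suc)
open import Data.Fin using (Fin; fromℕ)
open import Data.Fin.Subset using (Subset; ⊥)
open import Data.Product using (_×_)
open import Relation.Binary.PropositionalEquality using (_≡_)

open import Level using (Level)
open import Data.Fin using (zero; suc; inject₁)
open import Data.Fin.Properties using (any?; fromℕ≢inject₁) renaming (_≟_ to _≟ᶠ_)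
open import Data.Fin.Subset using (_∈_; _∉_; _⊆_; _⊂_; _─_; ⋃; ⋂; ∁; inside; outside)
open import Data.Fin.Subset.Properties
  using (_∈?_; _⊂?_; ∉⊥; ∈⊤; x∈p∪q⁺; x∈p∪q⁻; x∈p∩q⁺; x∈p∩q⁻; x∈p∧x∉q⇒x∈p─q; p─q⊆p;
         x∈∁p⇒x∉p; x∉p⇒x∈∁p; ⊆-antisym)
open import Data.Fin.Induction using (po-wellFounded)
open import Data.List.Base using ([]; _∷_; map; filter; allFin)
open import Data.List.Membership.Propositional using () renaming (_∈_ to _∈ₗ_)
open import Data.List.Membership.Propositional.Properties using (∈-filter⁺; ∈-filter⁻; ∈-allFin)
open import Data.List.Relation.Unary.Any using () renaming (here to hereₗ; there to thereₗ)
open import Data.Vec.Base using (_∷_; here; there; tabulate)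
open import Data.Vec.Properties using (lookup∘tabulate; []=⇒lookup; lookup⇒[]=)
open import Data.Product using (∃; _,_; proj₁; proj₂)
open import Data.Sum using (inj₁; inj₂)
open import Data.Empty using () renaming (⊥ to Empty; ⊥-elim to ⊥-elim)
open import Induction.WellFounded using (Acc; acc)
open import Relation.Nullary using (¬_; yes; no; does; contradiction)
open import Relation.Nullary.Decidable using (dec-true; _×-dec_; ¬?)
open import Relation.Unary using (Pred; Decidable)
open import Relation.Binary using (IsPartialOrder)
open import Relation.Binary.PropositionalEquality using (refl; sym; trans; subst)

private
  variable
    ℓ : Level
    n : ℕ
    A : Set

x∈p─q⇒x∉q : ∀ (p q : Subset n) {x} → x ∈ p ─ q → x ∉ q
x∈p─q⇒x∉q (inside ∷ p)  (inside ∷ q) () here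
x∈p─q⇒x∉q (outside ∷ p) (inside ∷ q) () here
x∈p─q⇒x∉q (_ ∷ p)       (_ ∷ q)      (there x∈p─q) (there x∈q) = x∈p─q⇒x∉q p q x∈p─q x∈q

module _ (f : A → Subset n) where

  ∈⋃⁺ : ∀ {xs a x} → a ∈ₗ xs → x ∈ f a → x ∈ ⋃ (map f xs)
  ∈⋃⁺ (hereₗ refl) x∈fa = x∈p∪q⁺ (inj₁ x∈fa)
  ∈⋃⁺ (thereₗ a∈) x∈fa = x∈p∪q⁺ (inj₂ (∈⋃⁺ a∈ x∈fa))

  ∈⋃⁻ : ∀ xs {x} → x ∈ ⋃ (map f xs) → ∃ λ a → a ∈ₗ xs × x ∈ f a
  ∈⋃⁻ []       x∈ = contradiction x∈ ∉⊥
  ∈⋃⁻ (b ∷ xs) x∈ with x∈p∪q⁻ (f b) (⋃ (map f xs)) x∈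
  ... | inj₁ x∈fb = b , hereₗ refl , x∈fb
  ... | inj₂ x∈⋃ with ∈⋃⁻ xs x∈⋃
  ...   | a , a∈ , x∈fa = a , thereₗ a∈ , x∈fa

  ∈⋂⁺ : ∀ xs {x} → (∀ {a} → a ∈ₗ xs → x ∈ f a) → x ∈ ⋂ (map f xs)
  ∈⋂⁺ []       _    = ∈⊤
  ∈⋂⁺ (b ∷ xs) x∈fs = x∈p∩q⁺ (x∈fs (hereₗ refl) , ∈⋂⁺ xs (λ a∈ → x∈fs (thereₗ a∈)))

  ∈⋂⁻ : ∀ xs {a x} → x ∈ ⋂ (map f xs) → a ∈ₗ xs → x ∈ f a
  ∈⋂⁻ (b ∷ xs) x∈ (hereₗ refl) = proj₁ (x∈p∩q⁻ (f b) _ x∈)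
  ∈⋂⁻ (b ∷ xs) x∈ (thereₗ a∈) = ∈⋂⁻ xs (proj₂ (x∈p∩q⁻ (f b) _ x∈)) a∈

module _ {k : ℕ} (f : Fin k → Subset n) {Q : Pred (Fin k) ℓ} (Q? : Decidable Q) where

  ∈⋃-filter⁺ : ∀ {a x} → Q a → x ∈ f a → x ∈ ⋃ (map f (filter Q? (allFin k)))
  ∈⋃-filter⁺ {a} qa = ∈⋃⁺ f (∈-filter⁺ Q? (∈-allFin a) qa)

  ∈⋃-filter⁻ : ∀ {x} → x ∈ ⋃ (map f (filter Q? (allFin k))) → ∃ λ a → Q a × x ∈ f a
  ∈⋃-filter⁻ x∈ with ∈⋃⁻ f (filter Q? (allFin k)) x∈
  ... | a , a∈ , x∈fa = a , proj₂ (∈-filter⁻ Q? {xs = allFin k} a∈) , x∈fa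

  ∈⋂-filter⁺ : ∀ {x} → (∀ {a} → Q a → x ∈ f a) → x ∈ ⋂ (map f (filter Q? (allFin k)))
  ∈⋂-filter⁺ x∈fs = ∈⋂⁺ f (filter Q? (allFin k)) (λ a∈ → x∈fs (proj₂ (∈-filter⁻ Q? {xs = allFin k} a∈)))

  ∈⋂-filter⁻ : ∀ {a x} → x ∈ ⋂ (map f (filter Q? (allFin k))) → Q a → x ∈ f a
  ∈⋂-filter⁻ {a} x∈ qa = ∈⋂⁻ f (filter Q? (allFin k)) x∈ (∈-filter⁺ Q? (∈-allFin a) qa)

select : {Q : Pred (Fin n) ℓ} → Decidable Q → Subset n
select Q? = tabulate (λ i → does (Q? i))

module _ {Q : Pred (Fin n) ℓ} (Q? : Decidable Q) where

  ∈select⁺ : ∀ {i} → Q i → i ∈ select Q?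
  ∈select⁺ {i} qi = lookup⇒[]= i _ (trans (lookup∘tabulate _ i) (dec-true (Q? i) qi))

  ∈select⁻ : ∀ {i} → i ∈ select Q? → Q i
  ∈select⁻ {i} i∈ with Q? i | trans (sym (lookup∘tabulate (λ j → does (Q? j)) i)) ([]=⇒lookup i∈)
  ... | yes qi | _ = qi
  ... | no _   | ()

data LastView (m : ℕ) : Fin (suc m) → Set where
  initial : (j : Fin m) → LastView m (inject₁ j)
  last    : LastView m (fromℕ m)

lastView : ∀ {m} (k : Fin (suc m)) → LastView m k
lastView {ℕ.zero} zero    = last
lastView {suc m}  zero    = initial zero
lastView {suc m}  (suc k) with lastView k
... | initial j = initial (suc j)
... | last      = last

snoc-inject₁ : ∀ {m} (f : Fin m → A) (a : A) (j : Fin m) → snoc f a (inject₁ j) ≡ f j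
snoc-inject₁ f a zero    = refl
snoc-inject₁ f a (suc j) = snoc-inject₁ (λ i → f (suc i)) a j

snoc-fromℕ : ∀ {m} (f : Fin m → A) (a : A) → snoc f a (fromℕ m) ≡ a
snoc-fromℕ {m = ℕ.zero} f a = refl
snoc-fromℕ {m = suc m}  f a = snoc-fromℕ (λ i → f (suc i)) a

module Minimality {N : ℕ} (P : FinPoset N) where
  open FinPoset P
  open IsPartialOrder isPartial using () renaming (trans to ≤-trans; reflexive to ≤-reflexive)

  _<P_ : Fin N → Fin N → Set
  j <P i = j ≤P i × ¬ j ≡ i

  Minimal : Pred (Fin N) ℓ → Pred (Fin N) ℓ
  Minimal Q i = Q i × (∀ {j} → j <P i → ¬ Q j)

  -- Below every element satisfying a decidable predicate there is a minimal
  -- one; by well-founded induction, as strict orders on Fin N are well-founded.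
  minimal-below : {Q : Pred (Fin N) ℓ} → Decidable Q →
                  ∀ {i} → Q i → ∃ λ i′ → i′ ≤P i × Minimal Q i′
  minimal-below {Q = Q} Q? {i} = go (po-wellFounded isPartial i)
    where
    go : ∀ {i} → Acc _<P_ i → Q i → ∃ λ i′ → i′ ≤P i × Minimal Q i′
    go {i} (acc below) qi with any? (λ j → ((j ≤P? i) ×-dec ¬? (j ≟ᶠ i)) ×-dec Q? j)
    ... | no none = i , ≤-reflexive refl , qi , λ j<i qj → none (_ , j<i , qj)
    ... | yes (j , j<i , qj) with go (below j<i) qj
    ...   | i′ , i′≤j , min = i′ , ≤-trans i′≤j (proj₁ j<i) , min

  minimals-antichain : {Q : Pred (Fin N) ℓ} {T : Subset N} →
                       (∀ {i} → i ∈ T → Minimal Q i) → IsAntichain P T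
  minimals-antichain T-min i i′ i∈T i′∈T i≤i′ with i ≟ᶠ i′
  ... | yes i≡i′ = i≡i′
  ... | no  i≢i′ = contradiction (proj₁ (T-min i∈T)) (proj₂ (T-min i′∈T) (i≤i′ , i≢i′))

module Trace {N : ℕ} (P : FinPoset N) {m′ : ℕ} (S : Fin (suc m′) → Subset N)
             {n : ℕ} (φ : Fin N → Subset n) where
  open FinPoset P
  open F1 P S φ using (Y; Z)
  open Minimality P

  Y⇒minimal : ∀ {x i} → x ∈ Y i → Minimal (λ j → x ∈ φ j) i
  Y⇒minimal {x} {i} x∈Y =
    p─q⊆p (φ i) _ x∈Y , λ j<i x∈φj → x∈p─q⇒x∉q (φ i) _ x∈Y (∈⋃-filter⁺ φ _ j<i x∈φj)

  minimal⇒Y : ∀ {x i} → Minimal (λ j → x ∈ φ j) i → x ∈ Y i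
  minimal⇒Y {x} {i} (x∈φi , below-out) = x∈p∧x∉q⇒x∈p─q x∈φi x∉⋃
    where
    x∉⋃ : x ∉ ⋃ (map φ (filter (λ j → (j ≤P? i) ×-dec ¬? (j ≟ᶠ i)) (allFin N)))
    x∉⋃ x∈⋃ with ∈⋃-filter⁻ φ _ x∈⋃
    ... | j , j<i , x∈φj = below-out j<i x∈φj

  trace : Fin n → Subset N
  trace x = select (λ i → x ∈? Y i)

  ∈trace⁺ : ∀ {x i} → x ∈ Y i → i ∈ trace x
  ∈trace⁺ {x} = ∈select⁺ (λ i → x ∈? Y i)

  ∈trace⁻ : ∀ {x i} → i ∈ trace x → x ∈ Y i
  ∈trace⁻ {x} = ∈select⁻ (λ i → x ∈? Y i)

  trace-minimal : ∀ {x i} → i ∈ trace x → Minimal (λ j → x ∈ φ j) i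
  trace-minimal i∈ = Y⇒minimal (∈trace⁻ i∈)

  trace-antichain : ∀ x → IsAntichain P (trace x)
  trace-antichain x = minimals-antichain (trace-minimal {x})

  Z⁺ : ∀ {x j} → S (inject₁ j) ⊆ trace x → x ∈ Z j
  Z⁺ {x} Sⱼ⊆ = ∈⋂-filter⁺ Y _ (λ i∈Sⱼ → ∈trace⁻ {x} (Sⱼ⊆ i∈Sⱼ))

  Z⁻ : ∀ {x j} → x ∈ Z j → S (inject₁ j) ⊆ trace x
  Z⁻ x∈Z i∈Sⱼ = ∈trace⁺ (∈⋂-filter⁻ Y _ x∈Z i∈Sⱼ)

  module _ (hom : IsHom P n φ) where

    below-trace⇒∈φ : ∀ {x i i′} → i′ ∈ trace x → i′ ≤P i → x ∈ φ i
    below-trace⇒∈φ {x} {i} {i′} i′∈ i′≤i = hom i′ i i′≤i (proj₁ (trace-minimal {x} i′∈))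

    ∈φ⇒below-trace : ∀ {x i} → x ∈ φ i → ∃ λ i′ → i′ ∈ trace x × i′ ≤P i
    ∈φ⇒below-trace {x} x∈φi with minimal-below (λ j → x ∈? φ j) x∈φi
    ... | i′ , i′≤i , min = i′ , ∈trace⁺ (minimal⇒Y min) , i′≤i

module Classification {N : ℕ} (P : FinPoset N) {m′ : ℕ} (S : Fin (suc m′) → Subset N)
                      (enum : IsAntichainEnum P S) (Sₘ≡⊥ : S (fromℕ m′) ≡ ⊥)
                      {n : ℕ} (φ : Fin N → Subset n) where
  open F1 P S φ using (Z; Aj; Am)
  open Trace P S φ

  S-covers : ∀ T → IsAntichain P T → ∃ λ k → S k ≡ T
  S-covers = proj₁ (proj₂ enum)

  S-injective : ∀ {k l} → S k ≡ S l → k ≡ l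
  S-injective = proj₂ (proj₂ enum) _ _

  -- A point of Aⱼ has no trace strictly above Sⱼ: that trace would be some
  -- Sₖ, which cannot be Sₘ = ∅ and would put the point into the removed Zₖ.
  Aj-trace-not-above : ∀ {x j} → x ∈ Aj j → ¬ (S (inject₁ j) ⊂ trace x)
  Aj-trace-not-above {x} {j} x∈A Sⱼ⊂ with S-covers (trace x) (trace-antichain x)
  ... | k , Sₖ≡ with lastView k
  ...   | last =
    ∉⊥ (subst (proj₁ (proj₂ Sⱼ⊂) ∈_) (trans (sym Sₖ≡) Sₘ≡⊥) (proj₁ (proj₂ (proj₂ Sⱼ⊂))))
  ...   | initial l = x∈p─q⇒x∉q (Z j) _ x∈A
    (∈⋃-filter⁺ Z _ (subst (S (inject₁ j) ⊂_) (sym Sₖ≡) Sⱼ⊂)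
                    (Z⁺ (λ {i} i∈ → subst (i ∈_) Sₖ≡ i∈)))

  Aj⁻ : ∀ {x j} → x ∈ Aj j → trace x ≡ S (inject₁ j)
  Aj⁻ {x} {j} x∈A = ⊆-antisym trace⊆Sⱼ Sⱼ⊆trace
    where
    Sⱼ⊆trace : S (inject₁ j) ⊆ trace x
    Sⱼ⊆trace = Z⁻ (p─q⊆p (Z j) _ x∈A)
    trace⊆Sⱼ : trace x ⊆ S (inject₁ j)
    trace⊆Sⱼ {i} i∈ with i ∈? S (inject₁ j)
    ... | yes i∈Sⱼ = i∈Sⱼ
    ... | no  i∉Sⱼ = ⊥-elim (Aj-trace-not-above x∈A (Sⱼ⊆trace , i , i∈ , i∉Sⱼ))

  Aj⁺ : ∀ {x j} → trace x ≡ S (inject₁ j) → x ∈ Aj j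
  Aj⁺ {x} {j} trace≡ = x∈p∧x∉q⇒x∈p─q (Z⁺ (λ {i} i∈ → subst (i ∈_) (sym trace≡) i∈)) x∉⋃
    where
    x∉⋃ : x ∉ ⋃ (map Z (filter (λ k → S (inject₁ j) ⊂? S (inject₁ k)) (allFin m′)))
    x∉⋃ x∈⋃ with ∈⋃-filter⁻ Z _ x∈⋃
    ... | k , (_ , i , i∈Sₖ , i∉Sⱼ) , x∈Zₖ = i∉Sⱼ (subst (i ∈_) trace≡ (Z⁻ x∈Zₖ i∈Sₖ))

  Am⁺ : ∀ {x} → trace x ≡ S (fromℕ m′) → x ∈ Am
  Am⁺ {x} trace≡ = x∉p⇒x∈∁p x∉⋃
    where
    x∉⋃ : x ∉ ⋃ (map Aj (allFin m′))
    x∉⋃ x∈⋃ with ∈⋃⁻ Aj (allFin m′) x∈⋃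
    ... | l , _ , x∈A = fromℕ≢inject₁ (S-injective (trans (sym trace≡) (Aj⁻ x∈A)))

  Am⁻ : ∀ {x} → x ∈ Am → trace x ≡ S (fromℕ m′)
  Am⁻ {x} x∈Am with S-covers (trace x) (trace-antichain x)
  ... | k , Sₖ≡ with lastView k
  ...   | last      = sym Sₖ≡
  ...   | initial l = contradiction (∈⋃⁺ Aj (∈-allFin l) (Aj⁺ (sym Sₖ≡))) (x∈∁p⇒x∉p x∈Am)

  f₁-trace⁺ : ∀ {x} k → trace x ≡ S k → x ∈ f₁ P S φ k
  f₁-trace⁺ {x} k trace≡ with lastView k
  ... | initial j = subst (x ∈_) (sym (snoc-inject₁ Aj Am j)) (Aj⁺ trace≡)
  ... | last      = subst (x ∈_) (sym (snoc-fromℕ Aj Am)) (Am⁺ trace≡)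

  f₁-trace⁻ : ∀ {x} k → x ∈ f₁ P S φ k → trace x ≡ S k
  f₁-trace⁻ {x} k x∈ with lastView k
  ... | initial j = Aj⁻ (subst (x ∈_) (snoc-inject₁ Aj Am j) x∈)
  ... | last      = Am⁻ (subst (x ∈_) (snoc-fromℕ Aj Am) x∈)

module _ {N : ℕ} (P : FinPoset N) {m′ : ℕ} (S : Fin (suc m′) → Subset N)
         (enum : IsAntichainEnum P S) (Sₘ≡⊥ : S (fromℕ m′) ≡ ⊥) {n : ℕ} where
  open Classification P S enum Sₘ≡⊥
  open Trace P S using (trace; trace-antichain; below-trace⇒∈φ; ∈φ⇒below-trace)

  -- Each point lies in the unique block indexed by its trace (this holds
  -- for every φ, not only for homomorphisms).
  f₁-partition : ∀ (φ : Fin N → Subset n) → IsOrderedPartition (f₁ P S φ)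
  f₁-partition φ = disjoint , covered
    where
    disjoint : ∀ j k → ¬ j ≡ k → ∀ x → x ∈ f₁ P S φ j → x ∈ f₁ P S φ k → Empty
    disjoint j k j≢k x x∈j x∈k =
      j≢k (S-injective φ (trans (sym (f₁-trace⁻ φ j x∈j)) (f₁-trace⁻ φ k x∈k)))
    covered : ∀ x → ∃ λ k → x ∈ f₁ P S φ k
    covered x with S-covers φ (trace φ x) (trace-antichain φ x)
    ... | k , Sₖ≡ = k , f₁-trace⁺ φ k (sym Sₖ≡)

  f₁-determines-trace : ∀ (φ ψ : Fin N → Subset n) → (∀ k → f₁ P S φ k ≡ f₁ P S ψ k) →
                        ∀ x → trace φ x ≡ trace ψ x
  f₁-determines-trace φ ψ f₁≡ x with S-covers φ (trace φ x) (trace-antichain φ x)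
  ... | k , Sₖ≡ = trans (sym Sₖ≡) (sym (f₁-trace⁻ ψ k x∈ψₖ))
    where
    x∈ψₖ : x ∈ f₁ P S ψ k
    x∈ψₖ = subst (x ∈_) (f₁≡ k) (f₁-trace⁺ φ k (sym Sₖ≡))

  -- A homomorphism is recovered from the traces, hence from f₁.
  f₁-injective-⊆ : ∀ (φ ψ : Fin N → Subset n) → IsHom P n φ → IsHom P n ψ →
                   (∀ k → f₁ P S φ k ≡ f₁ P S ψ k) → ∀ i → φ i ⊆ ψ i
  f₁-injective-⊆ φ ψ hφ hψ f₁≡ i {x} x∈φi with ∈φ⇒below-trace φ hφ x∈φi
  ... | i′ , i′∈ , i′≤i =
    below-trace⇒∈φ ψ hψ {x} (subst (i′ ∈_) (f₁-determines-trace φ ψ f₁≡ x) i′∈) i′≤i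

  f₁-injective : ∀ (φ ψ : Fin N → Subset n) → IsHom P n φ → IsHom P n ψ →
                 (∀ k → f₁ P S φ k ≡ f₁ P S ψ k) → ∀ i → φ i ≡ ψ i
  f₁-injective φ ψ hφ hψ f₁≡ i =
    ⊆-antisym (f₁-injective-⊆ φ ψ hφ hψ f₁≡ i) (f₁-injective-⊆ ψ φ hψ hφ (λ k → sym (f₁≡ k)) i)

lemma1 : ∀ {N : ℕ} (P : FinPoset N) {m' : ℕ} (S : Fin (suc m') → Subset N)
    → IsAntichainEnum P S → S (fromℕ m') ≡ ⊥ → (n : ℕ)
    → (∀ (φ : Fin N → Subset n) → IsHom P n φ → IsOrderedPartition (f₁ P S φ))
    × (∀ (φ ψ : Fin N → Subset n) → IsHom P n φ → IsHom P n ψ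
    → (∀ j → f₁ P S φ j ≡ f₁ P S ψ j) → ∀ i → φ i ≡ ψ i)
lemma1 P S enum Sₘ≡⊥ n =
  (λ φ _ → f₁-partition P S enum Sₘ≡⊥ φ) , f₁-injective P S enum Sₘ≡⊥
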